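{- For every integer $N > 2$, $\theta(J(N,2)) = N-2$.
   Context: For integers $0<k<N$, let $[N]=\{1,\dots,N\}$ and let $\mathcal{P}_k([N])$ be the set of $k$-element subsets of $[N]$. The Johnson graph $J(N,k)$ has vertex set $\mathcal{P}_k([N])$, two vertices $S_1,S_2$ being adjacent iff $|S_1\cap S_2| = k-1$. A (vertex) clique cover of a graph $G$ is a collection of cliques of $G$ whose vertex sets together contain every vertex of $G$; $\theta(G)$ denotes the smallest cardinality of a clique cover of $G$. -}

module Defs where

open import Data.Nat using (ℕ; _∸_; _≤_)
open import Data.Fin.Subset using (Subset; _∩_; ∣_∣)
open import Data.Product using (Σ; Σ-syntax; _×_; ∃-syntax; proj₁)
open import Data.List using (List; length)
open import Data.List.Relation.Unary.Any using (Any)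
open import Relation.Binary.PropositionalEquality using (_≡_; _≢_)

record Graph : Set₁ where
  field
    V   : Set
    Adj : V → V → Set

open Graph public

JVertex : ℕ → ℕ → Set
JVertex N k = Σ[ S ∈ Subset N ] ∣ S ∣ ≡ k

J : ℕ → ℕ → Graph
J N k = record
  { V   = JVertex N k
  ; Adj = λ S₁ S₂ → ∣ proj₁ S₁ ∩ proj₁ S₂ ∣ ≡ k ∸ 1
  }

IsClique : (G : Graph) → (V G → Set) → Set
IsClique G C = ∀ u v → C u → C v → u ≢ v → Adj G u v

Clique : Graph → Set₁
Clique G = Σ[ C ∈ (V G → Set) ] IsClique G C

IsCliqueCover : (G : Graph) → List (Clique G) → Set₁
IsCliqueCover G Cs = ∀ v → Any (λ C → proj₁ C v) Cs

CliqueCoverNumberIs : Graph → ℕ → Set₁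
CliqueCoverNumberIs G m =
  (Σ[ Cs ∈ List (Clique G) ] (IsCliqueCover G Cs × length Cs ≡ m))
  × (∀ (Cs : List (Clique G)) → IsCliqueCover G Cs → m ≤ length Cs)

-- The vertices of J(N,2) are the edges of K_N, and a clique of J(N,2) is a family of pairwise
-- meeting edges, so a clique cover by m cliques is an m-colouring of the edges of K_N in which
-- edges of equal colour meet. The triangle on {0,1,2} with the stars at the other N - 3
-- vertices is such a cover by N - 2 cliques. Conversely N ≤ m + 2, by induction on N: if some
-- colour class lies in the star of a vertex x, delete x and that colour; otherwise every colour
-- class has an edge avoiding any given vertex, which forces each colour to occur at most twice
-- among the 2(N - 2) edges joining 0 and 1 to the other vertices, whence N - 2 ≤ m.
module Submission where

open import Defs
open import Data.Nat using (ℕ; zero; suc; _+_; _*_; _∸_; _≤_; _<_; z≤n; s≤s)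
open import Data.Nat.Properties
  using (≤-antisym; ≤-pred; ≤∧≢⇒<; <⇒≱; m<n⇒0<n; m≤n⇒m≤1+n; *-cancelʳ-≤; m≤n+o⇒m∸n≤o;
         0≢1+n; ≡-irrelevant; ≤-refl; ≤-reflexive; +-suc; module ≤-Reasoning)
  renaming (_≟_ to _≟ℕ_)
open import Data.Fin using (Fin; zero; suc; punchIn; punchOut; remQuot; combine; _↑ˡ_; _↑ʳ_)
open import Data.Fin.Properties
  using (suc-injective; punchIn-injective; punchInᵢ≢i; punchOut-injective; combine-remQuot;
         ↑ˡ-injective; ↑ʳ-injective; any?; _≟_)
open import Data.Fin.Subset
  using (Subset; _∩_; _∪_; ∣_∣; _∈_; _⊆_; ⁅_⁆; Nonempty; Empty; inside; outside)
  renaming (⊥ to ∅)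
open import Data.Fin.Subset.Properties
  using (p⊆q⇒∣p∣≤∣q∣; drop-∷-⊆; ∣⁅x⁆∣≡1; x∈⁅y⁆⇒x≡y; nonempty?; Empty-unique; ∣⊥∣≡0;
         ∣p∩q∣≤∣p∣; p∩q⊆p; p∩q⊆q; x∈p∩q⁻; x∈p∩q⁺; x∈p∪q⁻; x∈p⇒∣p-x∣<∣p∣; ∩-idem)
open import Data.Product using (Σ-syntax; ∃-syntax; _×_; _,_; proj₁; proj₂; uncurry)
open import Data.Sum using (_⊎_; inj₁; inj₂; [_,_]′)
import Data.Sum as Sum
open import Data.Vec using ([]; _∷_; here; there)
open import Data.List using (List; length; _∷_; tabulate; lookup)
open import Data.List.Properties using (length-tabulate)
open import Data.List.Relation.Unary.Any using (here; there; index)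
open import Data.List.Relation.Unary.Any.Properties using (lookup-index; tabulate⁺)
open import Data.Empty using (⊥; ⊥-elim; ⊥-elim-irr)
open import Relation.Nullary using (¬_; yes; no)
open import Relation.Nullary.Decidable using (Dec; recompute; decidable-stable; ¬?; _×-dec_; _⊎-dec_; map′)
open import Relation.Binary.PropositionalEquality using (_≡_; _≢_; refl; sym; trans; cong; cong₂; subst; module ≡-Reasoning)
open import Function using (_∘_; id)
open import Function.Definitions using (Injective)

infix 4 _∈⟨_,_⟩

_∈⟨_,_⟩ : {A : Set} → A → A → A → Set
x ∈⟨ i , j ⟩ = x ≡ i ⊎ x ≡ j

pigeonhole-pair : {A : Set} {p q x y z : A} →
  x ∈⟨ p , q ⟩ → y ∈⟨ p , q ⟩ → z ∈⟨ p , q ⟩ → x ≡ y ⊎ x ≡ z ⊎ y ≡ z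
pigeonhole-pair (inj₁ refl) (inj₁ refl) _           = inj₁ refl
pigeonhole-pair (inj₂ refl) (inj₂ refl) _           = inj₁ refl
pigeonhole-pair (inj₁ refl) (inj₂ refl) (inj₁ refl) = inj₂ (inj₁ refl)
pigeonhole-pair (inj₁ refl) (inj₂ refl) (inj₂ refl) = inj₂ (inj₂ refl)
pigeonhole-pair (inj₂ refl) (inj₁ refl) (inj₁ refl) = inj₂ (inj₂ refl)
pigeonhole-pair (inj₂ refl) (inj₁ refl) (inj₂ refl) = inj₂ (inj₁ refl)

Distinct₃ : {A : Set} → A → A → A → Set
Distinct₃ a b c = a ≢ b × a ≢ c × b ≢ c

Distinct₃-coincide : {A : Set} {a b c : A} → Distinct₃ a b c → ¬ (a ≡ b ⊎ a ≡ c ⊎ b ≡ c)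
Distinct₃-coincide (a≢b , a≢c , b≢c) = [ a≢b , [ a≢c , b≢c ]′ ]′

Distinct₃-map⁺ : {A B : Set} {f : A → B} {a b c : A} →
  Injective _≡_ _≡_ f → Distinct₃ a b c → Distinct₃ (f a) (f b) (f c)
Distinct₃-map⁺ f-inj (a≢b , a≢c , b≢c) = a≢b ∘ f-inj , a≢c ∘ f-inj , b≢c ∘ f-inj

Distinct₃-map⁻ : {A B : Set} (f : A → B) {a b c : A} →
  Distinct₃ (f a) (f b) (f c) → Distinct₃ a b c
Distinct₃-map⁻ f (fa≢fb , fa≢fc , fb≢fc) = fa≢fb ∘ cong f , fa≢fc ∘ cong f , fb≢fc ∘ cong f

AtMostTwoToOne : {A B : Set} → (A → B) → Set
AtMostTwoToOne f = ∀ {a b c} → Distinct₃ a b c → f a ≡ f b → f a ≡ f c → ⊥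

AtMostTwoToOne-∘ : {A B C : Set} {f : B → C} {h : A → B} →
  Injective _≡_ _≡_ h → AtMostTwoToOne f → AtMostTwoToOne (f ∘ h)
AtMostTwoToOne-∘ h-inj f-2 = f-2 ∘ Distinct₃-map⁺ h-inj

AtMostTwoToOne-punchOut : ∀ {A : Set} {m} {f : A → Fin (suc m)} {v} (v≢f : ∀ a → v ≢ f a) →
  AtMostTwoToOne f → AtMostTwoToOne (λ a → punchOut (v≢f a))
AtMostTwoToOne-punchOut v≢f f-2 d e₁ e₂ =
  f-2 d (punchOut-injective (v≢f _) (v≢f _) e₁) (punchOut-injective (v≢f _) (v≢f _) e₂)

-- Remove the value f 0 and its fibre, which has one or two points.
AtMostTwoToOne⇒n≤m*2 : ∀ {n m} (f : Fin n → Fin m) → AtMostTwoToOne f → n ≤ m * 2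
AtMostTwoToOne⇒n≤m*2 {zero} _ _ = z≤n
AtMostTwoToOne⇒n≤m*2 {suc n} {zero} f _ with f zero
... | ()
AtMostTwoToOne⇒n≤m*2 {suc n} {suc m} f f-2 with any? (λ j → f zero ≟ f (suc j))
... | no ∄ = s≤s (m≤n⇒m≤1+n (AtMostTwoToOne⇒n≤m*2 _
               (AtMostTwoToOne-punchOut v≢f (AtMostTwoToOne-∘ suc-injective f-2))))
  where
  v≢f : ∀ j → f zero ≢ f (suc j)
  v≢f j e = ∄ (j , e)
AtMostTwoToOne⇒n≤m*2 {suc (suc n)} {suc m} f f-2 | yes (j , e) =
  s≤s (s≤s (AtMostTwoToOne⇒n≤m*2 _ (AtMostTwoToOne-punchOut v≢f (AtMostTwoToOne-∘ h-injective f-2))))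
  where
  h : Fin n → Fin (suc (suc n))
  h = suc ∘ punchIn j
  h-injective : Injective _≡_ _≡_ h
  h-injective = punchIn-injective j _ _ ∘ suc-injective
  v≢f : ∀ a → f zero ≢ f (h a)
  v≢f a e′ = f-2 ((λ ()) , (λ ()) , punchInᵢ≢i j a ∘ sym ∘ suc-injective) e e′
AtMostTwoToOne⇒n≤m*2 {suc zero} {suc m} f f-2 | yes (() , _)

-- Edges are ordered pairs of distinct vertices, and c i j need not equal c j i. The proof of
-- i ≢ j is irrelevant, so the colour depends on the pair only.
EdgeColouring : ℕ → ℕ → Set
EdgeColouring N m = (i j : Fin N) → .(i ≢ j) → Fin m

Meet : ∀ {N} → Fin N → Fin N → Fin N → Fin N → Set
Meet i j i′ j′ = ∃[ x ] x ∈⟨ i , j ⟩ × x ∈⟨ i′ , j′ ⟩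

meet-reflect : ∀ {N N′} {f : Fin N → Fin N′} {i j i′ j′} →
  Injective _≡_ _≡_ f → Meet (f i) (f j) (f i′) (f j′) → Meet i j i′ j′
meet-reflect f-inj (_ , inj₁ refl , x∈) = _ , inj₁ refl , Sum.map f-inj f-inj x∈
meet-reflect f-inj (_ , inj₂ refl , x∈) = _ , inj₂ refl , Sum.map f-inj f-inj x∈

meet-avoiding : ∀ {N} {i j x y : Fin N} → Meet i j x y → ¬ x ∈⟨ i , j ⟩ → y ∈⟨ i , j ⟩
meet-avoiding (_ , z∈ij , inj₁ refl) x∉ij = ⊥-elim (x∉ij z∈ij)
meet-avoiding (_ , z∈ij , inj₂ refl) _    = z∈ij

Intersecting : ∀ {N m} → EdgeColouring N m → Set
Intersecting c = ∀ i j i′ j′ .(i≢j : i ≢ j) .(i′≢j′ : i′ ≢ j′) →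
  c i j i≢j ≡ c i′ j′ i′≢j′ → Meet i j i′ j′

module _ {N m} (c : EdgeColouring N m) where

  StarAt : Fin m → Fin N → Set
  StarAt k x = ∀ i j .(i≢j : i ≢ j) → c i j i≢j ≡ k → x ∈⟨ i , j ⟩

  Escapes : Fin m → Fin N → Set
  Escapes k x = ∃[ i ] ∃[ j ] Σ[ i≢j ∈ i ≢ j ] c i j i≢j ≡ k × ¬ x ∈⟨ i , j ⟩

  escapes? : ∀ k x → Dec (Escapes k x)
  escapes? k x = any? λ i → any? λ j → escapesBy? i j
    where
    escapesBy? : ∀ i j → Dec (Σ[ i≢j ∈ i ≢ j ] c i j i≢j ≡ k × ¬ x ∈⟨ i , j ⟩)
    escapesBy? i j with i ≟ j
    ... | yes i≡j = no λ (i≢j , _) → i≢j i≡j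
    ... | no i≢j  = map′ (i≢j ,_) proj₂ (c i j i≢j ≟ k ×-dec ¬? (x ≟ i ⊎-dec x ≟ j))

  ¬escapes⇒starAt : ∀ {k x} → ¬ Escapes k x → StarAt k x
  ¬escapes⇒starAt {x = x} ¬esc i j i≢j e = decidable-stable (x ≟ i ⊎-dec x ≟ j)
    λ x∉ij → ¬esc (i , j , (λ i≡j → ⊥-elim-irr (i≢j i≡j)) , e , x∉ij)

  star-or-escaping : (∃[ k ] ∃[ x ] StarAt k x) ⊎ (∀ k x → Escapes k x)
  star-or-escaping with any? (λ k → any? (λ x → ¬? (escapes? k x)))
  ... | yes (k , x , ¬esc) = inj₁ (k , x , ¬escapes⇒starAt ¬esc)
  ... | no ∄ = inj₂ λ k x → decidable-stable (escapes? k x) (λ ¬esc → ∄ (k , x , ¬esc))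

module DeleteStar {N m} (c : EdgeColouring (suc N) (suc m)) {k x} (star : StarAt c k x) where

  k≢colour : ∀ i j .(i≢j : i ≢ j) → k ≢ c (punchIn x i) (punchIn x j) (i≢j ∘ punchIn-injective x i j)
  k≢colour i j i≢j k≡ = [ punchInᵢ≢i x i ∘ sym , punchInᵢ≢i x j ∘ sym ]′ (star _ _ _ (sym k≡))

  colouring : EdgeColouring N m
  colouring i j i≢j = punchOut (k≢colour i j i≢j)

  intersecting : Intersecting c → Intersecting colouring
  intersecting int i j i′ j′ i≢j i′≢j′ same = meet-reflect (punchIn-injective x _ _)
    (int _ _ _ _ _ _ (punchOut-injective (k≢colour i j i≢j) (k≢colour i′ j′ i′≢j′) same))

module Spokes {M m} (c : EdgeColouring (2 + M) m) (int : Intersecting c)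
              (escapes : ∀ k x → Escapes c k x) where

  hub : Fin 2 → Fin (2 + M)
  hub b = b ↑ˡ M

  rim : Fin M → Fin (2 + M)
  rim t = 2 ↑ʳ t

  hub≢rim : ∀ b t → hub b ≢ rim t
  hub≢rim zero       _ ()
  hub≢rim (suc zero) _ ()

  fin2∈⟨0,1⟩ : (b : Fin 2) → b ∈⟨ zero , suc zero ⟩
  fin2∈⟨0,1⟩ zero       = inj₁ refl
  fin2∈⟨0,1⟩ (suc zero) = inj₂ refl

  spokeColour : Fin M × Fin 2 → Fin m
  spokeColour (t , b) = c (hub b) (rim t) (hub≢rim b t)

  meeting-spokes : ∀ {b b′ t t′} → Meet (hub b) (rim t) (hub b′) (rim t′) → b ≡ b′ ⊎ t ≡ t′
  meeting-spokes (_ , inj₁ refl , inj₁ e) = inj₁ (↑ˡ-injective M _ _ e)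
  meeting-spokes (_ , inj₁ refl , inj₂ e) = ⊥-elim (hub≢rim _ _ e)
  meeting-spokes (_ , inj₂ refl , inj₁ e) = ⊥-elim (hub≢rim _ _ (sym e))
  meeting-spokes (_ , inj₂ refl , inj₂ e) = inj₂ (↑ʳ-injective 2 _ _ e)

  -- An edge of colour k avoiding the hub must meet all three spokes at their rim ends.
  three-spokes-at-hub : ∀ {b t₁ t₂ t₃ k} → Distinct₃ t₁ t₂ t₃ →
    spokeColour (t₁ , b) ≡ k → spokeColour (t₂ , b) ≡ k → spokeColour (t₃ , b) ≡ k → ⊥
  three-spokes-at-hub {b} {k = k} d e₁ e₂ e₃ with escapes k (hub b)
  ... | p , q , p≢q , eₚ , hub∉pq =
    Distinct₃-coincide (Distinct₃-map⁺ (↑ʳ-injective 2 _ _) d)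
      (pigeonhole-pair (rim∈pq e₁) (rim∈pq e₂) (rim∈pq e₃))
    where
    rim∈pq : ∀ {t} → spokeColour (t , b) ≡ k → rim t ∈⟨ p , q ⟩
    rim∈pq e = meet-avoiding (int _ _ _ _ p≢q (hub≢rim b _) (trans eₚ (sym e))) hub∉pq

  two-spokes-at-hub : ∀ {b t₁ t₂ X k} → Distinct₃ (t₁ , b) (t₂ , b) X →
    spokeColour (t₁ , b) ≡ k → spokeColour (t₂ , b) ≡ k → spokeColour X ≡ k → ⊥
  two-spokes-at-hub {b} {X = t₃ , b₃} {k} d e₁ e₂ e₃ with b₃ ≟ b
  ... | yes refl = three-spokes-at-hub (Distinct₃-map⁻ (_, b) d) e₁ e₂ e₃
  ... | no b₃≢b  = proj₁ d (cong (_, b) (trans (sym (t₃≡ e₁)) (t₃≡ e₂)))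
    where
    t₃≡ : ∀ {t} → spokeColour (t , b) ≡ k → t₃ ≡ t
    t₃≡ e = [ ⊥-elim ∘ b₃≢b , id ]′ (meeting-spokes (int _ _ _ _ _ _ (trans e₃ (sym e))))

  spokeColour-atMostTwoToOne : AtMostTwoToOne spokeColour
  spokeColour-atMostTwoToOne {_ , b₁} {_ , b₂} {_ , b₃} (d₁₂ , d₁₃ , d₂₃) e₁₂ e₁₃
    with pigeonhole-pair (fin2∈⟨0,1⟩ b₁) (fin2∈⟨0,1⟩ b₂) (fin2∈⟨0,1⟩ b₃)
  ... | inj₁ refl        = two-spokes-at-hub (d₁₂ , d₁₃ , d₂₃) refl (sym e₁₂) (sym e₁₃)
  ... | inj₂ (inj₁ refl) = two-spokes-at-hub (d₁₃ , d₁₂ , d₂₃ ∘ sym) refl (sym e₁₃) (sym e₁₂)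
  ... | inj₂ (inj₂ refl) = two-spokes-at-hub (d₂₃ , d₁₂ ∘ sym , d₁₃ ∘ sym) (sym e₁₂) (sym e₁₃) refl

  M≤m : M ≤ m
  M≤m = *-cancelʳ-≤ M m 2 (AtMostTwoToOne⇒n≤m*2 (spokeColour ∘ remQuot 2)
          (AtMostTwoToOne-∘ remQuot-injective spokeColour-atMostTwoToOne))
    where
    remQuot-injective : Injective _≡_ _≡_ (remQuot {M} 2)
    remQuot-injective {a} {a′} e =
      trans (sym (combine-remQuot {M} 2 a)) (trans (cong (uncurry combine) e) (combine-remQuot {M} 2 a′))

escaping⇒N≤2+m : ∀ {N m} (c : EdgeColouring N m) → Intersecting c → (∀ k x → Escapes c k x) → N ≤ 2 + m
escaping⇒N≤2+m {zero}        _ _   _   = z≤n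
escaping⇒N≤2+m {suc zero}    _ _   _   = s≤s z≤n
escaping⇒N≤2+m {suc (suc M)} c int esc = s≤s (s≤s (Spokes.M≤m c int esc))

intersecting⇒N≤2+m : ∀ {N m} (c : EdgeColouring N m) → Intersecting c → N ≤ 2 + m
intersecting⇒N≤2+m c int with star-or-escaping c
intersecting⇒N≤2+m {suc N} {suc m} c int | inj₁ (_ , _ , star) =
  s≤s (intersecting⇒N≤2+m colouring (intersecting int))
  where open DeleteStar c star
intersecting⇒N≤2+m {zero}          _ _   | inj₁ (_ , () , _)
intersecting⇒N≤2+m {suc N} {zero}  _ _   | inj₁ (() , _ , _)
intersecting⇒N≤2+m c int | inj₂ esc = escaping⇒N≤2+m c int esc

∣p∩q∣+∣p∪q∣≡∣p∣+∣q∣ : ∀ {n} (p q : Subset n) → ∣ p ∩ q ∣ + ∣ p ∪ q ∣ ≡ ∣ p ∣ + ∣ q ∣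
∣p∩q∣+∣p∪q∣≡∣p∣+∣q∣ [] [] = refl
∣p∩q∣+∣p∪q∣≡∣p∣+∣q∣ (outside ∷ p) (outside ∷ q) = ∣p∩q∣+∣p∪q∣≡∣p∣+∣q∣ p q
∣p∩q∣+∣p∪q∣≡∣p∣+∣q∣ (outside ∷ p) (inside ∷ q) =
  trans (+-suc ∣ p ∩ q ∣ _) (trans (cong suc (∣p∩q∣+∣p∪q∣≡∣p∣+∣q∣ p q)) (sym (+-suc ∣ p ∣ _)))
∣p∩q∣+∣p∪q∣≡∣p∣+∣q∣ (inside ∷ p) (outside ∷ q) =
  trans (+-suc ∣ p ∩ q ∣ _) (cong suc (∣p∩q∣+∣p∪q∣≡∣p∣+∣q∣ p q))
∣p∩q∣+∣p∪q∣≡∣p∣+∣q∣ (inside ∷ p) (inside ∷ q) =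
  cong suc (trans (+-suc ∣ p ∩ q ∣ _) (trans (cong suc (∣p∩q∣+∣p∪q∣≡∣p∣+∣q∣ p q)) (sym (+-suc ∣ p ∣ _))))

Empty⇒∣p∣≡0 : ∀ {n} {p : Subset n} → Empty p → ∣ p ∣ ≡ 0
Empty⇒∣p∣≡0 {n} p-empty = trans (cong ∣_∣ (Empty-unique p-empty)) (∣⊥∣≡0 n)

∣p∣≢0⇒Nonempty : ∀ {n} {p : Subset n} → ∣ p ∣ ≢ 0 → Nonempty p
∣p∣≢0⇒Nonempty {p = p} ∣p∣≢0 = decidable-stable (nonempty? p) (∣p∣≢0 ∘ Empty⇒∣p∣≡0)

Nonempty⇒0<∣p∣ : ∀ {n} {p : Subset n} → Nonempty p → 0 < ∣ p ∣
Nonempty⇒0<∣p∣ (_ , x∈p) = m<n⇒0<n (x∈p⇒∣p-x∣<∣p∣ x∈p)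

p⊆q∧∣q∣≤∣p∣⇒p≡q : ∀ {n} {p q : Subset n} → p ⊆ q → ∣ q ∣ ≤ ∣ p ∣ → p ≡ q
p⊆q∧∣q∣≤∣p∣⇒p≡q {p = []}          {[]}          _   _ = refl
p⊆q∧∣q∣≤∣p∣⇒p≡q {p = outside ∷ p} {outside ∷ q} p⊆q ∣q∣≤∣p∣ =
  cong (outside ∷_) (p⊆q∧∣q∣≤∣p∣⇒p≡q (drop-∷-⊆ p⊆q) ∣q∣≤∣p∣)
p⊆q∧∣q∣≤∣p∣⇒p≡q {p = outside ∷ p} {inside ∷ q}  p⊆q ∣q∣≤∣p∣ =
  ⊥-elim (<⇒≱ ∣q∣≤∣p∣ (p⊆q⇒∣p∣≤∣q∣ (drop-∷-⊆ p⊆q)))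
p⊆q∧∣q∣≤∣p∣⇒p≡q {p = inside ∷ p}  {outside ∷ q} p⊆q _ with p⊆q here
... | ()
p⊆q∧∣q∣≤∣p∣⇒p≡q {p = inside ∷ p}  {inside ∷ q}  p⊆q ∣q∣≤∣p∣ =
  cong (inside ∷_) (p⊆q∧∣q∣≤∣p∣⇒p≡q (drop-∷-⊆ p⊆q) (≤-pred ∣q∣≤∣p∣))

∣r∣<∣p∣+∣q∣⇒Nonempty[p∩q] : ∀ {n} {p q r : Subset n} → p ⊆ r → q ⊆ r →
  ∣ r ∣ < ∣ p ∣ + ∣ q ∣ → Nonempty (p ∩ q)
∣r∣<∣p∣+∣q∣⇒Nonempty[p∩q] {p = p} {q} {r} p⊆r q⊆r ∣r∣< = ∣p∣≢0⇒Nonempty λ ∣p∩q∣≡0 → <⇒≱ ∣r∣< (begin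
  ∣ p ∣ + ∣ q ∣          ≡⟨ sym (∣p∩q∣+∣p∪q∣≡∣p∣+∣q∣ p q) ⟩
  ∣ p ∩ q ∣ + ∣ p ∪ q ∣  ≡⟨ cong (_+ ∣ p ∪ q ∣) ∣p∩q∣≡0 ⟩
  ∣ p ∪ q ∣              ≤⟨ p⊆q⇒∣p∣≤∣q∣ (λ x∈ → [ p⊆r , q⊆r ]′ (x∈p∪q⁻ p q x∈)) ⟩
  ∣ r ∣                  ∎)
  where open ≤-Reasoning

JVertex-≡ : ∀ {N k} {u v : JVertex N k} → proj₁ u ≡ proj₁ v → u ≡ v
JVertex-≡ {u = S , ∣S∣≡k} {.S , ∣S∣≡k′} refl = cong (S ,_) (≡-irrelevant ∣S∣≡k ∣S∣≡k′)

meeting⇒adjacent : ∀ {N} (u v : JVertex N 2) → u ≢ v → Nonempty (proj₁ u ∩ proj₁ v) → Adj (J N 2) u v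
meeting⇒adjacent (S , ∣S∣≡2) (T , ∣T∣≡2) u≢v S∩T-nonempty =
  ≤-antisym (≤-pred (≤∧≢⇒< ∣S∩T∣≤2 ∣S∩T∣≢2)) (Nonempty⇒0<∣p∣ S∩T-nonempty)
  where
  ∣S∩T∣≤2 : ∣ S ∩ T ∣ ≤ 2
  ∣S∩T∣≤2 = subst (∣ S ∩ T ∣ ≤_) ∣S∣≡2 (∣p∩q∣≤∣p∣ S T)
  ∣S∩T∣≢2 : ∣ S ∩ T ∣ ≢ 2
  ∣S∩T∣≢2 ∣S∩T∣≡2 = u≢v (JVertex-≡ (trans (sym (S∩T≡ (p∩q⊆p S T) ∣S∣≡2)) (S∩T≡ (p∩q⊆q S T) ∣T∣≡2)))
    where
    S∩T≡ : ∀ {R} → S ∩ T ⊆ R → ∣ R ∣ ≡ 2 → S ∩ T ≡ R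
    S∩T≡ S∩T⊆R ∣R∣≡2 = p⊆q∧∣q∣≤∣p∣⇒p≡q S∩T⊆R (≤-reflexive (trans ∣R∣≡2 (sym ∣S∩T∣≡2)))

clique-members-meet : ∀ {N} (C : Clique (J N 2)) {u v} → proj₁ C u → proj₁ C v →
  Nonempty (proj₁ u ∩ proj₁ v)
clique-members-meet (_ , isClique) {u} {v} u∈C v∈C = decidable-stable (nonempty? _) λ disjoint →
  disjoint (∣p∣≢0⇒Nonempty λ ∣∩∣≡0 → 0≢1+n (trans (sym ∣∩∣≡0) (isClique u v u∈C v∈C (u≢v disjoint))))
  where
  u≢v : Empty (proj₁ u ∩ proj₁ v) → u ≢ v
  u≢v disjoint refl = disjoint (subst Nonempty (sym (∩-idem (proj₁ u)))
    (∣p∣≢0⇒Nonempty λ ∣u∣≡0 → 0≢1+n (trans (sym ∣u∣≡0) (proj₂ u))))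

star : ∀ {N} → Fin N → Clique (J N 2)
star x = (λ v → x ∈ proj₁ v) , λ u v x∈u x∈v u≢v → meeting⇒adjacent u v u≢v (x , x∈p∩q⁺ (x∈u , x∈v))

firstThree : ∀ n → Subset (3 + n)
firstThree n = inside ∷ inside ∷ inside ∷ ∅

triangle : ∀ n → Clique (J (3 + n) 2)
triangle n = (λ v → proj₁ v ⊆ firstThree n) , λ u v u⊆ v⊆ u≢v →
  meeting⇒adjacent u v u≢v (∣r∣<∣p∣+∣q∣⇒Nonempty[p∩q] u⊆ v⊆ (∣firstThree∣<∣S∣+∣T∣ u v))
  where
  ∣firstThree∣<∣S∣+∣T∣ : (u v : JVertex (3 + n) 2) → ∣ firstThree n ∣ < ∣ proj₁ u ∣ + ∣ proj₁ v ∣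
  ∣firstThree∣<∣S∣+∣T∣ (_ , ∣S∣≡2) (_ , ∣T∣≡2) rewrite ∣⊥∣≡0 n | ∣S∣≡2 | ∣T∣≡2 = ≤-refl

cliqueCover : ∀ n → List (Clique (J (3 + n) 2))
cliqueCover n = triangle n ∷ tabulate (star ∘ (3 ↑ʳ_))

cliqueCover-covers : ∀ n → IsCliqueCover (J (3 + n) 2) (cliqueCover n)
cliqueCover-covers n (a ∷ b ∷ c ∷ r , _) with nonempty? r
... | yes (i , i∈r) = there (tabulate⁺ i (there (there (there i∈r))))
... | no r-empty    = here ⊆firstThree
  where
  ⊆firstThree : a ∷ b ∷ c ∷ r ⊆ firstThree n
  ⊆firstThree here                        = here
  ⊆firstThree (there here)                = there here
  ⊆firstThree (there (there here))        = there (there here)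
  ⊆firstThree (there (there (there i∈r))) = ⊥-elim (r-empty (_ , i∈r))

cliqueCover-length : ∀ n → length (cliqueCover n) ≡ suc n
cliqueCover-length n = cong suc (length-tabulate (star ∘ (3 ↑ʳ_)))

∈⁅i⁆∪⁅j⁆⇒∈⟨i,j⟩ : ∀ {N} {x i j : Fin N} → x ∈ ⁅ i ⁆ ∪ ⁅ j ⁆ → x ∈⟨ i , j ⟩
∈⁅i⁆∪⁅j⁆⇒∈⟨i,j⟩ {i = i} {j} x∈ = Sum.map (x∈⁅y⁆⇒x≡y i) (x∈⁅y⁆⇒x≡y j) (x∈p∪q⁻ ⁅ i ⁆ ⁅ j ⁆ x∈)

∣⁅i⁆∪⁅j⁆∣≡2 : ∀ {N} {i j : Fin N} → i ≢ j → ∣ ⁅ i ⁆ ∪ ⁅ j ⁆ ∣ ≡ 2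
∣⁅i⁆∪⁅j⁆∣≡2 {i = i} {j} i≢j = begin
  ∣ ⁅ i ⁆ ∪ ⁅ j ⁆ ∣                        ≡⟨ cong (_+ ∣ ⁅ i ⁆ ∪ ⁅ j ⁆ ∣) (sym ∣⁅i⁆∩⁅j⁆∣≡0) ⟩
  ∣ ⁅ i ⁆ ∩ ⁅ j ⁆ ∣ + ∣ ⁅ i ⁆ ∪ ⁅ j ⁆ ∣  ≡⟨ ∣p∩q∣+∣p∪q∣≡∣p∣+∣q∣ ⁅ i ⁆ ⁅ j ⁆ ⟩
  ∣ ⁅ i ⁆ ∣ + ∣ ⁅ j ⁆ ∣                    ≡⟨ cong₂ _+_ (∣⁅x⁆∣≡1 i) (∣⁅x⁆∣≡1 j) ⟩
  2                                        ∎
  where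
  open ≡-Reasoning
  ∣⁅i⁆∩⁅j⁆∣≡0 : ∣ ⁅ i ⁆ ∩ ⁅ j ⁆ ∣ ≡ 0
  ∣⁅i⁆∩⁅j⁆∣≡0 = Empty⇒∣p∣≡0 λ (x , x∈) →
    let x∈⁅i⁆ , x∈⁅j⁆ = x∈p∩q⁻ ⁅ i ⁆ ⁅ j ⁆ x∈ in i≢j (trans (sym (x∈⁅y⁆⇒x≡y i x∈⁅i⁆)) (x∈⁅y⁆⇒x≡y j x∈⁅j⁆))

edge : ∀ {N} (i j : Fin N) → .(i ≢ j) → JVertex N 2
edge i j i≢j = ⁅ i ⁆ ∪ ⁅ j ⁆ , recompute (∣ ⁅ i ⁆ ∪ ⁅ j ⁆ ∣ ≟ℕ 2) (∣⁅i⁆∪⁅j⁆∣≡2 i≢j)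

edges-meet : ∀ {N} {i j i′ j′ : Fin N} → Nonempty ((⁅ i ⁆ ∪ ⁅ j ⁆) ∩ (⁅ i′ ⁆ ∪ ⁅ j′ ⁆)) → Meet i j i′ j′
edges-meet (x , x∈) = let x∈u , x∈v = x∈p∩q⁻ _ _ x∈ in x , ∈⁅i⁆∪⁅j⁆⇒∈⟨i,j⟩ x∈u , ∈⁅i⁆∪⁅j⁆⇒∈⟨i,j⟩ x∈v

module _ {N} {Cs : List (Clique (J N 2))} (covers : IsCliqueCover (J N 2) Cs) where

  coverColouring : EdgeColouring N (length Cs)
  coverColouring i j i≢j = index (covers (edge i j i≢j))

  coverColouring-intersecting : Intersecting coverColouring
  coverColouring-intersecting i j i′ j′ i≢j i′≢j′ same =
    edges-meet (clique-members-meet (lookup Cs (coverColouring i j i≢j)) (lookup-index (covers u)) v∈C)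
    where
    u v : JVertex N 2
    u = edge i j i≢j
    v = edge i′ j′ i′≢j′
    v∈C : proj₁ (lookup Cs (coverColouring i j i≢j)) v
    v∈C = subst (λ n → proj₁ (lookup Cs n) v) (sym same) (lookup-index (covers v))

N∸2≤length : ∀ {N} {Cs : List (Clique (J N 2))} → IsCliqueCover (J N 2) Cs → N ∸ 2 ≤ length Cs
N∸2≤length {N} covers =
  m≤n+o⇒m∸n≤o N 2 (intersecting⇒N≤2+m (coverColouring covers) (coverColouring-intersecting covers))

theorem2p3 : ∀ (N : ℕ) → 2 < N → CliqueCoverNumberIs (J N 2) (N ∸ 2)
theorem2p3 (suc (suc (suc n))) (s≤s (s≤s (s≤s _))) =
  (cliqueCover n , cliqueCover-covers n , cliqueCover-length n) , λ _ → N∸2≤length
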